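{- Let $d\ge 1$ and $n>d$ be integers, and let $T\in L(n,d)$ with $T\neq\emptyset$. Then the poset ideal $\mathcal{I}_{n,d}(T)$ is isomorphic, as a poset, to the direct product $\prod_{T_i\in T}\mathcal{I}_{n,d}(\{T_i\})$, and both are isomorphic, as posets, to $\prod_{T_i\in T} L(n-|T_i|,\,d-|T_i|)$.
   Context: For a finite set $X$ put $\operatorname{codim}_d(X)=d+1-|X|$. For a finite collection $\{T_1,\dots,T_l\}$ of pairwise distinct finite sets put $\rho_d(\{T_1,\dots,T_l\})=\sum_{i=1}^l\operatorname{codim}_d(T_i)$ (with $\rho_d(\emptyset)=0$) and $D_d(\{T_1,\dots,T_l\})=\operatorname{codim}_d(T_1\cap\cdots\cap T_l)-\rho_d(\{T_1,\dots,T_l\})$. For integers $d\ge1$, $n>d$, let $L(n,d)$ be the set of all $T\subset 2^{\{1,\dots,n\}}$ (collections of subsets of $\{1,\dots,n\}$) such that (1) $D_d(T')>0$ for every $T'\subset T$ with $|T'|>1$, and (2) $0\le |T_i|\le d$ for every $T_i\in T$. It is partially ordered by: $T<T'$ iff $\rho_d(T)<\rho_d(T')$ and for every $T_i\in T$ there exists $T'_j\in T'$ with $T'_j\subset T_i$; $T\le T'$ means $T<T'$ or $T=T'$. Its minimum is $\emptyset$ and its maximum is $\{\emptyset\}$. For $d=0$ (and any $n>0$), $L(n,0)$ is the two-element poset $\{\emptyset,\{\emptyset\}\}$ with $\emptyset<\{\emptyset\}$. (The poset $L(n,d)$ is the intersection lattice, with the empty intersection included as top element, of the arrangement of affine hyperplanes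 in $K^d$ spanned by $d$-subsets of $n$ generic points.) For $T\in L(n,d)$, $\mathcal{I}_{n,d}(T)=\{S\in L(n,d): S\le T\}$ is the poset ideal generated by $T$. -}

module Defs where

open import Data.Bool using (Bool; true; false; if_then_else_)
open import Data.Nat as ℕ using (ℕ; zero; suc; _∸_)
open import Data.Integer as ℤ using (ℤ; +_; _-_; _+_; _<_; 0ℤ)
open import Data.Fin.Subset using (Subset; _⊆_; ∣_∣; _∩_; ⊤)
open import Data.Vec using ([]; _∷_)
open import Data.Vec.Properties using (≡-dec)
open import Data.List using (List; []; _∷_; map; _++_; foldr; length; filterᵇ)
open import Data.Product using (Σ; ∃; _×_; _,_; proj₁)
open import Data.Sum using (_⊎_)
open import Relation.Binary.PropositionalEquality using (_≡_)
open import Relation.Binary.Core using (Rel)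
open import Relation.Binary.Morphism.Structures using (IsOrderIsomorphism)
import Data.Bool.Properties as BoolP
open import Relation.Nullary.Decidable using (does)

-- A collection T ⊂ 2^{1..n} of subsets is given by its (Boolean)
-- membership predicate; two collections are equal iff they have the
-- same members (pointwise equality '_≐_').

Coll : ℕ → Set
Coll n = Subset n → Bool

_≐_ : ∀ {n} → Coll n → Coll n → Set
T ≐ T' = ∀ X → T X ≡ T' X

_⊆ᶜ_ : ∀ {n} → Coll n → Coll n → Set
T' ⊆ᶜ T = ∀ X → T' X ≡ true → T X ≡ true

∅ᶜ : ∀ {n} → Coll n
∅ᶜ _ = false

｛_｝ : ∀ {n} → Subset n → Coll n
｛ X ｝ Y = does (≡-dec BoolP._≟_ Y X)

allSubsets : (n : ℕ) → List (Subset n)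
allSubsets zero = [] ∷ []
allSubsets (suc n) = map (false ∷_) (allSubsets n) ++ map (true ∷_) (allSubsets n)

size : ∀ {n} → Coll n → ℕ
size {n} T = length (filterᵇ T (allSubsets n))

codim : ∀ {n} (d : ℕ) → Subset n → ℤ
codim d X = + suc d - + ∣ X ∣

ρ : ∀ {n} (d : ℕ) → Coll n → ℤ
ρ {n} d T = foldr (λ X acc → (if T X then codim d X else 0ℤ) + acc) 0ℤ (allSubsets n)

⋂ : ∀ {n} → Coll n → Subset n
⋂ {n} T = foldr (λ X acc → if T X then X ∩ acc else acc) ⊤ (allSubsets n)

D : ∀ {n} (d : ℕ) → Coll n → ℤ
D d T = codim d (⋂ T) - ρ d T

InL : (n d : ℕ) → Coll n → Set
InL n d T =
  (∀ (T' : Coll n) → T' ⊆ᶜ T → 1 ℕ.< size T' → 0ℤ < D d T')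
  × (∀ X → T X ≡ true → ∣ X ∣ ℕ.≤ d)

L : (n d : ℕ) → Set
L n d = Σ (Coll n) (InL n d)

_<[_]_ : ∀ {n} → Coll n → ℕ → Coll n → Set
T <[ d ] T' = (ρ d T < ρ d T')
  × (∀ X → T X ≡ true → ∃ λ Y → T' Y ≡ true × Y ⊆ X)

_≤[_]_ : ∀ {n} → Coll n → ℕ → Coll n → Set
T ≤[ d ] T' = T <[ d ] T' ⊎ T ≐ T'

record Pos : Set₁ where
  field
    Carrier : Set
    _≈_ : Rel Carrier _
    _≤_ : Rel Carrier _

_≅_ : Pos → Pos → Set
P ≅ Q = ∃ λ (f : Pos.Carrier P → Pos.Carrier Q) →
  IsOrderIsomorphism (Pos._≈_ P) (Pos._≈_ Q) (Pos._≤_ P) (Pos._≤_ Q) f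

Lₚ : (n d : ℕ) → Pos
Lₚ n d = record
  { Carrier = L n d
  ; _≈_ = λ S S' → proj₁ S ≐ proj₁ S'
  ; _≤_ = λ S S' → proj₁ S ≤[ d ] proj₁ S' }

Ideal : (n d : ℕ) → Coll n → Pos
Ideal n d T = record
  { Carrier = Σ (L n d) (λ S → proj₁ S ≤[ d ] T)
  ; _≈_ = λ S S' → proj₁ (proj₁ S) ≐ proj₁ (proj₁ S')
  ; _≤_ = λ S S' → proj₁ (proj₁ S) ≤[ d ] proj₁ (proj₁ S') }

Πₚ : (I : Set) → (I → Pos) → Pos
Πₚ I P = record
  { Carrier = (i : I) → Pos.Carrier (P i)
  ; _≈_ = λ f g → ∀ i → Pos._≈_ (P i) (f i) (g i)
  ; _≤_ = λ f g → ∀ i → Pos._≤_ (P i) (f i) (g i) }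

Mem : ∀ {n} → Coll n → Set
Mem {n} T = Σ (Subset n) (λ X → T X ≡ true)

module Submission where

-- The key fact (unique-below) is that two members of a collection with
-- D > 0 never lie in a common set of size ≤ d.  So every member of S ≤ T
-- contains exactly one member Y of T and S is the disjoint union of its
-- blocks S_Y = {Z ∈ S : Y ⊆ Z}.  Writing ρ, |·| and ⋂ as sums over all
-- subsets (FiniteSum) and splitting them by blocks gives the comparison
-- criterion (comparison): if each member of a D-positive R contains
-- exactly one member of a bounded Q, then R ≤ Q.  With it the order of
-- I(T) is checked blockwise; conversely D-positive blocks over distinct
-- members of T glue to a D-positive union (union-DPositive, by
-- inclusion–exclusion).  Contraction along Y shifts every codimension by
-- |Y| and identifies I({Y}) with L(n-|Y|, d-|Y|) (Contraction).

open import Defs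
open import Data.Nat using (ℕ; _≤_; _<_; _∸_)
open import Data.Product using (_×_; proj₁)
open import Data.Fin.Subset using (∣_∣)
open import Relation.Nullary using (¬_)

open import Data.Bool using (Bool; true; false; if_then_else_; _∧_; _∨_; not)
import Data.Bool.Properties as BP
import Data.Nat as N
import Data.Nat.Properties as NP
import Data.Nat.Tactic.RingSolver as NatSolver
import Data.Integer as Z
import Data.Integer.Properties as ZP
open import Data.Integer.Tactic.RingSolver using (solve-∀)
open import Data.Vec using ([]; _∷_)
import Data.Vec as V
import Data.Vec.Properties as VP
open import Data.List using (List; []; _∷_; _++_; map; foldr; filterᵇ; length)
open import Data.List.Membership.Propositional using (_∈_)
open import Data.List.Relation.Unary.Any using (here; there)
import Data.List.Membership.Propositional.Properties as MP
open import Data.Fin.Subset using (Subset; _⊆_; _∩_; _∪_; ⊤; ⊥)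
import Data.Fin.Subset.Properties as SP
open import Data.Product using (Σ; ∃; _,_; proj₂)
open import Data.Sum using (_⊎_; inj₁; inj₂; [_,_])
open import Data.Empty using (⊥-elim)
open import Relation.Binary.PropositionalEquality hiding ([_]; J)
open import Relation.Nullary using (Dec; yes; no; does)
open import Relation.Nullary.Decidable using (dec-true; dec-false)
open import Relation.Binary.Morphism.Structures using (IsOrderIsomorphism)
import Axiom.UniquenessOfIdentityProofs as UIP
open import Algebra.Properties.AbelianGroup ZP.+-0-abelianGroup using (∙-cancelˡ)

∧-true⁻ˡ : ∀ {a b : Bool} → a ∧ b ≡ true → a ≡ true
∧-true⁻ˡ {true} _ = refl

∧-true⁻ʳ : ∀ {a b : Bool} → a ∧ b ≡ true → b ≡ true
∧-true⁻ʳ {true} e = e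

∧-true⁺ : ∀ {a b : Bool} → a ≡ true → b ≡ true → a ∧ b ≡ true
∧-true⁺ refl refl = refl

false≢true : ∀ {A : Set} → false ≡ true → A
false≢true ()

bool-irrelevant : ∀ {a b : Bool} (p q : a ≡ b) → p ≡ q
bool-irrelevant = UIP.Decidable⇒UIP.≡-irrelevant BP._≟_

if-cong : ∀ {A : Set} {b c : Bool} (x y : A) → b ≡ c → (if b then x else y) ≡ (if c then x else y)
if-cong x y refl = refl

if-∧ : ∀ {A : Set} (b c : Bool) (x y : A) → (if b ∧ c then x else y) ≡ (if b then (if c then x else y) else y)
if-∧ true c x y = refl
if-∧ false c x y = refl

_⊆ᵇ_ : ∀ {n} → Subset n → Subset n → Bool
W ⊆ᵇ Z = does (W SP.⊆? Z)

⊆ᵇ-sound : ∀ {n} {W Z : Subset n} → W ⊆ᵇ Z ≡ true → W ⊆ Z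
⊆ᵇ-sound {W = W} {Z} e with W SP.⊆? Z
... | yes W⊆Z = W⊆Z

⊆ᵇ-complete : ∀ {n} {W Z : Subset n} → W ⊆ Z → W ⊆ᵇ Z ≡ true
⊆ᵇ-complete {W = W} {Z} = dec-true (W SP.⊆? Z)

｛｝-refl : ∀ {n} (X : Subset n) → ｛ X ｝ X ≡ true
｛｝-refl X = dec-true (VP.≡-dec BP._≟_ X X) refl

｛｝-member : ∀ {n} {X Y : Subset n} → ｛ X ｝ Y ≡ true → Y ≡ X
｛｝-member {X = X} {Y} e with VP.≡-dec BP._≟_ Y X
... | yes Y≡X = Y≡X

｛｝-other : ∀ {n} {X Y : Subset n} → Y ≢ X → ｛ X ｝ Y ≡ false
｛｝-other {X = X} {Y} = dec-false (VP.≡-dec BP._≟_ Y X)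

∩-glb : ∀ {n} {W A B : Subset n} → W ⊆ A → W ⊆ B → W ⊆ A ∩ B
∩-glb W⊆A W⊆B x∈W = SP.x∈p∩q⁺ (W⊆A x∈W , W⊆B x∈W)

∪-lub : ∀ {n} {X Y Z : Subset n} → X ⊆ Z → Y ⊆ Z → X ∪ Y ⊆ Z
∪-lub {X = X} {Y} X⊆Z Y⊆Z x∈X∪Y = [ X⊆Z , Y⊆Z ] (SP.x∈p∪q⁻ X Y x∈X∪Y)

∩-mono : ∀ {n} {X A Q P : Subset n} → X ⊆ A → Q ⊆ P → X ∩ Q ⊆ A ∩ P
∩-mono {X = X} {Q = Q} X⊆A Q⊆P =
  ∩-glb (SP.⊆-trans (SP.p∩q⊆p X Q) X⊆A) (SP.⊆-trans (SP.p∩q⊆q X Q) Q⊆P)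

∪-mono : ∀ {n} {X A Q P : Subset n} → X ⊆ A → Q ⊆ P → X ∪ Q ⊆ A ∪ P
∪-mono {A = A} {P = P} X⊆A Q⊆P =
  ∪-lub (SP.⊆-trans X⊆A (SP.p⊆p∪q P)) (SP.⊆-trans Q⊆P (SP.q⊆p∪q A P))

⊆-card-≡ : ∀ {n} {p q : Subset n} → p ⊆ q → ∣ p ∣ ≡ ∣ q ∣ → p ≡ q
⊆-card-≡ {p = []} {[]} _ _ = refl
⊆-card-≡ {p = false ∷ p} {false ∷ q} p⊆q c = cong (false ∷_) (⊆-card-≡ (SP.drop-∷-⊆ p⊆q) c)
⊆-card-≡ {p = false ∷ p} {true ∷ q} p⊆q c =
  ⊥-elim (NP.<-irrefl refl (NP.≤-trans (NP.≤-reflexive (sym c)) (SP.p⊆q⇒∣p∣≤∣q∣ (SP.drop-∷-⊆ p⊆q))))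
⊆-card-≡ {p = true ∷ p} {true ∷ q} p⊆q c =
  cong (true ∷_) (⊆-card-≡ (SP.drop-∷-⊆ p⊆q) (NP.suc-injective c))
⊆-card-≡ {p = true ∷ p} {false ∷ q} p⊆q _ with p⊆q V.here
... | ()

∣∩∣+∣∪∣ : ∀ {n} (p q : Subset n) → ∣ p ∣ N.+ ∣ q ∣ ≡ ∣ p ∩ q ∣ N.+ ∣ p ∪ q ∣
∣∩∣+∣∪∣ [] [] = refl
∣∩∣+∣∪∣ (true ∷ p) (true ∷ q) =
  cong N.suc (trans (NP.+-suc ∣ p ∣ ∣ q ∣) (trans (cong N.suc (∣∩∣+∣∪∣ p q)) (sym (NP.+-suc _ _))))
∣∩∣+∣∪∣ (true ∷ p) (false ∷ q) = trans (cong N.suc (∣∩∣+∣∪∣ p q)) (sym (NP.+-suc _ _))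
∣∩∣+∣∪∣ (false ∷ p) (true ∷ q) =
  trans (NP.+-suc ∣ p ∣ ∣ q ∣) (trans (cong N.suc (∣∩∣+∣∪∣ p q)) (sym (NP.+-suc _ _)))
∣∩∣+∣∪∣ (false ∷ p) (false ∷ q) = ∣∩∣+∣∪∣ p q

-- |Y ∪ I| ≤ |A ∪ J| for Y ⊆ A and I ⊆ J, written through
-- inclusion–exclusion so that no subtraction occurs.
∣∪∣-mono : ∀ {n} {Y A I J : Subset n} → Y ⊆ A → I ⊆ J →
  ∣ Y ∣ N.+ ∣ I ∣ N.+ ∣ A ∩ J ∣ ≤ ∣ A ∣ N.+ ∣ J ∣ N.+ ∣ Y ∩ I ∣
∣∪∣-mono {Y = Y} {A} {I} {J} Y⊆A I⊆J =
  subst₂ N._≤_ (cong (N._+ ∣ A ∩ J ∣) (sym (∣∩∣+∣∪∣ Y I)))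
    (trans (rearrange (∣ Y ∩ I ∣) (∣ A ∪ J ∣) (∣ A ∩ J ∣)) (cong (N._+ ∣ Y ∩ I ∣) (sym (∣∩∣+∣∪∣ A J))))
    (NP.+-monoˡ-≤ ∣ A ∩ J ∣ (NP.+-monoʳ-≤ ∣ Y ∩ I ∣ (SP.p⊆q⇒∣p∣≤∣q∣ (∪-mono Y⊆A I⊆J))))
  where
  rearrange : ∀ z u x → z N.+ u N.+ x ≡ x N.+ u N.+ z
  rearrange = NatSolver.solve-∀

-- Sets containing Y correspond to subsets of
-- the complement of Y, which has `cosize Y = n - |Y|` points: `expand Y`
-- adds Y to a subset of the complement and `compress Y` forgets the points
-- of Y.  This identifies the part of L(n,d) above Y with L(n-|Y|, d-|Y|).

cosize : ∀ {n} → Subset n → ℕ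
cosize [] = 0
cosize (false ∷ Y) = N.suc (cosize Y)
cosize (true ∷ Y) = cosize Y

expand : ∀ {n} (Y : Subset n) → Subset (cosize Y) → Subset n
expand [] [] = []
expand (false ∷ Y) (b ∷ X) = b ∷ expand Y X
expand (true ∷ Y) X = true ∷ expand Y X

compress : ∀ {n} (Y : Subset n) → Subset n → Subset (cosize Y)
compress [] [] = []
compress (false ∷ Y) (b ∷ Z) = b ∷ compress Y Z
compress (true ∷ Y) (b ∷ Z) = compress Y Z

cosize≡ : ∀ {n} (Y : Subset n) → cosize Y ≡ n ∸ ∣ Y ∣
cosize≡ {n} Y = trans (sym (NP.m+n∸n≡m (cosize Y) ∣ Y ∣)) (cong (_∸ ∣ Y ∣) (cosize+∣∣ Y))
  where
  cosize+∣∣ : ∀ {n} (Y : Subset n) → cosize Y N.+ ∣ Y ∣ ≡ n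
  cosize+∣∣ [] = refl
  cosize+∣∣ (false ∷ Y) = cong N.suc (cosize+∣∣ Y)
  cosize+∣∣ (true ∷ Y) = trans (NP.+-suc _ _) (cong N.suc (cosize+∣∣ Y))

compress-expand : ∀ {n} (Y : Subset n) X → compress Y (expand Y X) ≡ X
compress-expand [] [] = refl
compress-expand (false ∷ Y) (b ∷ X) = cong (b ∷_) (compress-expand Y X)
compress-expand (true ∷ Y) X = compress-expand Y X

expand-compress : ∀ {n} (Y Z : Subset n) → Y ⊆ Z → expand Y (compress Y Z) ≡ Z
expand-compress [] [] _ = refl
expand-compress (false ∷ Y) (b ∷ Z) Y⊆Z = cong (b ∷_) (expand-compress Y Z (SP.drop-∷-⊆ Y⊆Z))
expand-compress (true ∷ Y) (true ∷ Z) Y⊆Z = cong (true ∷_) (expand-compress Y Z (SP.drop-∷-⊆ Y⊆Z))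
expand-compress (true ∷ Y) (false ∷ Z) Y⊆Z with Y⊆Z V.here
... | ()

⊆-expand : ∀ {n} (Y : Subset n) X → Y ⊆ expand Y X
⊆-expand [] [] = SP.⊆-refl
⊆-expand (false ∷ Y) (b ∷ X) = SP.out⊆ (⊆-expand Y X)
⊆-expand (true ∷ Y) X = SP.in⊆in (⊆-expand Y X)

∣expand∣ : ∀ {n} (Y : Subset n) X → ∣ expand Y X ∣ ≡ ∣ X ∣ N.+ ∣ Y ∣
∣expand∣ [] [] = refl
∣expand∣ (false ∷ Y) (true ∷ X) = cong N.suc (∣expand∣ Y X)
∣expand∣ (false ∷ Y) (false ∷ X) = ∣expand∣ Y X
∣expand∣ (true ∷ Y) X = trans (cong N.suc (∣expand∣ Y X)) (sym (NP.+-suc _ _))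

expand-∩ : ∀ {n} (Y : Subset n) a b → expand Y (a ∩ b) ≡ expand Y a ∩ expand Y b
expand-∩ [] [] [] = refl
expand-∩ (false ∷ Y) (x ∷ a) (y ∷ b) = cong ((x ∧ y) ∷_) (expand-∩ Y a b)
expand-∩ (true ∷ Y) a b = cong (true ∷_) (expand-∩ Y a b)

expand-⊤ : ∀ {n} (Y : Subset n) → expand Y ⊤ ≡ ⊤
expand-⊤ [] = refl
expand-⊤ (false ∷ Y) = cong (true ∷_) (expand-⊤ Y)
expand-⊤ (true ∷ Y) = cong (true ∷_) (expand-⊤ Y)

expand-⊥ : ∀ {n} (Y : Subset n) → expand Y ⊥ ≡ Y
expand-⊥ [] = refl
expand-⊥ (false ∷ Y) = cong (false ∷_) (expand-⊥ Y)
expand-⊥ (true ∷ Y) = cong (true ∷_) (expand-⊥ Y)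

compress-self : ∀ {n} (Y : Subset n) → compress Y Y ≡ ⊥
compress-self [] = refl
compress-self (false ∷ Y) = cong (false ∷_) (compress-self Y)
compress-self (true ∷ Y) = compress-self Y

∷-⊆ : ∀ {m n} {x y} {p q : Subset m} {p' q' : Subset n} → x ∷ p ⊆ y ∷ q → p' ⊆ q' → x ∷ p' ⊆ y ∷ q'
∷-⊆ {x = false} _ p'⊆q' = SP.out⊆ p'⊆q'
∷-⊆ {x = true} {true} _ p'⊆q' = SP.in⊆in p'⊆q'
∷-⊆ {x = true} {false} xp⊆yq _ with xp⊆yq V.here
... | ()

expand-mono : ∀ {n} (Y : Subset n) {a b} → a ⊆ b → expand Y a ⊆ expand Y b
expand-mono [] {[]} {[]} _ = SP.⊆-refl
expand-mono (false ∷ Y) {x ∷ a} {y ∷ b} a⊆b = ∷-⊆ a⊆b (expand-mono Y (SP.drop-∷-⊆ a⊆b))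
expand-mono (true ∷ Y) a⊆b = SP.in⊆in (expand-mono Y a⊆b)

compress-⊆ : ∀ {n} (Y : Subset n) {W} X → W ⊆ expand Y X → compress Y W ⊆ X
compress-⊆ [] {[]} [] _ = SP.⊆-refl
compress-⊆ (false ∷ Y) {w ∷ W} (x ∷ X) W⊆ = ∷-⊆ W⊆ (compress-⊆ Y X (SP.drop-∷-⊆ W⊆))
compress-⊆ (true ∷ Y) {w ∷ W} X W⊆ = compress-⊆ Y X (SP.drop-∷-⊆ W⊆)

restrict : ∀ {n} → Coll n → Subset n → Coll n
restrict R W Z = R Z ∧ W ⊆ᵇ Z

-- {Y ∪ X : X ∈ R'}: a collection on the complement of Y, moved back to n points.
lift : ∀ {n} (Y : Subset n) → Coll (cosize Y) → Coll n
lift Y R' Z = Y ⊆ᵇ Z ∧ R' (compress Y Z)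

pair : ∀ {n} → Subset n → Subset n → Coll n
pair Y Y' X = ｛ Y ｝ X ∨ ｛ Y' ｝ X

Refines : ∀ {n} → Coll n → Coll n → Set
Refines {n} R Q = ∀ Z → R Z ≡ true → ∃ λ W → Q W ≡ true × W ⊆ Z

UniquelyRefines : ∀ {n} → Coll n → Coll n → Set
UniquelyRefines {n} R Q = ∀ Z → R Z ≡ true →
  ∃ λ W → Q W ≡ true × W ⊆ Z × (∀ W' → Q W' ≡ true → W' ⊆ Z → W' ≡ W)

-- Sums over a list in a commutative monoid.  ρ_d(R) is by definition the
-- sum `over R (codim d)` in ℤ, and |R| and ⋂R are sums over R in ℕ and in
-- the ∩-monoid of subsets (size-as-sum, ⋂-as-sum); the decompositions of
-- collections used below are identities between such sums.
module FiniteSum {M : Set} (_∙_ : M → M → M) (ε : M)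
  (identityˡ : ∀ x → ε ∙ x ≡ x) (identityʳ : ∀ x → x ∙ ε ≡ x)
  (assoc : ∀ x y z → (x ∙ y) ∙ z ≡ x ∙ (y ∙ z))
  (comm : ∀ x y → x ∙ y ≡ y ∙ x) where

  ∑ : {A : Set} → (A → M) → List A → M
  ∑ h = foldr (λ x acc → h x ∙ acc) ε

  over : ∀ {n} → Coll n → (Subset n → M) → M
  over {n} R h = ∑ (λ Z → if R Z then h Z else ε) (allSubsets n)

  ∑-cong : ∀ {A : Set} {h k : A → M} → (∀ x → h x ≡ k x) → ∀ l → ∑ h l ≡ ∑ k l
  ∑-cong e [] = refl
  ∑-cong e (x ∷ l) = cong₂ _∙_ (e x) (∑-cong e l)

  ∑-zero : ∀ {A : Set} {h : A → M} → (∀ x → h x ≡ ε) → ∀ l → ∑ h l ≡ ε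
  ∑-zero e [] = refl
  ∑-zero e (x ∷ l) = trans (cong₂ _∙_ (e x) (∑-zero e l)) (identityˡ ε)

  ∑-++ : ∀ {A : Set} (h : A → M) l₁ l₂ → ∑ h (l₁ ++ l₂) ≡ ∑ h l₁ ∙ ∑ h l₂
  ∑-++ h [] l₂ = sym (identityˡ _)
  ∑-++ h (x ∷ l₁) l₂ = trans (cong (h x ∙_) (∑-++ h l₁ l₂)) (sym (assoc _ _ _))

  ∑-map : ∀ {A B : Set} (h : B → M) (g : A → B) l → ∑ h (map g l) ≡ ∑ (λ x → h (g x)) l
  ∑-map h g [] = refl
  ∑-map h g (x ∷ l) = cong (h (g x) ∙_) (∑-map h g l)

  ∑-∙ : ∀ {A : Set} (h k : A → M) l → ∑ (λ x → h x ∙ k x) l ≡ ∑ h l ∙ ∑ k l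
  ∑-∙ h k [] = sym (identityˡ ε)
  ∑-∙ h k (x ∷ l) = begin
    (h x ∙ k x) ∙ ∑ (λ x → h x ∙ k x) l ≡⟨ cong ((h x ∙ k x) ∙_) (∑-∙ h k l) ⟩
    (h x ∙ k x) ∙ (H ∙ K)                ≡⟨ assoc (h x) (k x) (H ∙ K) ⟩
    h x ∙ (k x ∙ (H ∙ K))                ≡⟨ cong (h x ∙_) (sym (assoc (k x) H K)) ⟩
    h x ∙ ((k x ∙ H) ∙ K)                ≡⟨ cong (λ w → h x ∙ (w ∙ K)) (comm (k x) H) ⟩
    h x ∙ ((H ∙ k x) ∙ K)                ≡⟨ cong (h x ∙_) (assoc H (k x) K) ⟩
    h x ∙ (H ∙ (k x ∙ K))                ≡⟨ sym (assoc (h x) H (k x ∙ K)) ⟩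
    (h x ∙ H) ∙ (k x ∙ K)                ∎
    where
    open ≡-Reasoning
    H = ∑ h l
    K = ∑ k l

  ∑-swap : ∀ {A B : Set} (g : A → B → M) l₁ l₂ →
    ∑ (λ a → ∑ (g a) l₂) l₁ ≡ ∑ (λ b → ∑ (λ a → g a b) l₁) l₂
  ∑-swap g [] l₂ = sym (∑-zero (λ _ → refl) l₂)
  ∑-swap g (a ∷ l₁) l₂ =
    trans (cong (∑ (g a) l₂ ∙_) (∑-swap g l₁ l₂)) (sym (∑-∙ (g a) (λ b → ∑ (λ a' → g a' b) l₁) l₂))

  ∑-allSubsets-suc : ∀ {n} (h : Subset (N.suc n) → M) →
    ∑ h (allSubsets (N.suc n)) ≡ ∑ (λ Y → h (false ∷ Y)) (allSubsets n) ∙ ∑ (λ Y → h (true ∷ Y)) (allSubsets n)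
  ∑-allSubsets-suc {n} h = trans (∑-++ h (map (false ∷_) A) (map (true ∷_) A)) (cong₂ _∙_ (∑-map h _ A) (∑-map h _ A))
    where A = allSubsets n

  ∑-single : ∀ {n} (h : Subset n → M) (Y₀ : Subset n) →
    (∀ Y → Y ≢ Y₀ → h Y ≡ ε) → ∑ h (allSubsets n) ≡ h Y₀
  ∑-single {N.zero} h [] _ = identityʳ _
  ∑-single {N.suc n} h (false ∷ Y₀) off =
    trans (∑-allSubsets-suc h)
      (trans (cong₂ _∙_ (∑-single (λ Y → h (false ∷ Y)) Y₀ (λ Y ne → off _ (λ eq → ne (cong V.tail eq))))
                        (∑-zero (λ Y → off _ (λ ())) (allSubsets n)))
             (identityʳ _))
  ∑-single {N.suc n} h (true ∷ Y₀) off =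
    trans (∑-allSubsets-suc h)
      (trans (cong₂ _∙_ (∑-zero (λ Y → off _ (λ ())) (allSubsets n))
                        (∑-single (λ Y → h (true ∷ Y)) Y₀ (λ Y ne → off _ (λ eq → ne (cong V.tail eq)))))
             (identityˡ _))

  over-cong : ∀ {n} {R R' : Coll n} (h : Subset n → M) → R ≐ R' → over R h ≡ over R' h
  over-cong {n} h R≐R' = ∑-cong (λ X → if-cong (h X) ε (R≐R' X)) (allSubsets n)

  over-congʳ : ∀ {n} (R : Coll n) {h k : Subset n → M} → (∀ X → h X ≡ k X) → over R h ≡ over R k
  over-congʳ {n} R h≡k = ∑-cong (λ X → cong (λ v → if R X then v else ε) (h≡k X)) (allSubsets n)

  over-∅ : ∀ {n} {R : Coll n} (h : Subset n → M) → (∀ Z → R Z ≡ false) → over R h ≡ ε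
  over-∅ {n} h none = ∑-zero (λ X → if-cong (h X) ε (none X)) (allSubsets n)

  over-｛｝ : ∀ {n} {R : Coll n} {X} (h : Subset n → M) → R ≐ ｛ X ｝ → over R h ≡ h X
  over-｛｝ {X = X} h R≐X =
    trans (∑-single _ X (λ Y ne → if-cong _ _ (trans (R≐X Y) (｛｝-other ne))))
          (if-cong _ _ (trans (R≐X X) (｛｝-refl X)))

  over-pair : ∀ {n} {Y Y' : Subset n} (h : Subset n → M) → Y ≢ Y' → over (pair Y Y') h ≡ h Y ∙ h Y'
  over-pair {n} {Y} {Y'} h Y≢Y' =
    trans (∑-cong split (allSubsets n))
      (trans (∑-∙ _ _ (allSubsets n)) (cong₂ _∙_ (over-｛｝ h (λ _ → refl)) (over-｛｝ h (λ _ → refl))))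
    where
    split : ∀ X → (if pair Y Y' X then h X else ε)
                  ≡ (if ｛ Y ｝ X then h X else ε) ∙ (if ｛ Y' ｝ X then h X else ε)
    split X with ｛ Y ｝ X in e | ｛ Y' ｝ X in e'
    ... | true | true = ⊥-elim (Y≢Y' (trans (sym (｛｝-member {X = Y} {Y = X} e)) (｛｝-member {X = Y'} {Y = X} e')))
    ... | true | false = sym (identityʳ _)
    ... | false | true = sym (identityˡ _)
    ... | false | false = sym (identityˡ ε)

  ∑-above : ∀ {n} (Y : Subset n) (h : Subset n → M) →
    ∑ (λ Z → if Y ⊆ᵇ Z then h Z else ε) (allSubsets n) ≡ ∑ (λ X → h (expand Y X)) (allSubsets (cosize Y))
  ∑-above [] h = refl
  ∑-above {N.suc n} (false ∷ Y) h =
    trans (∑-allSubsets-suc {n} _)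
      (trans (cong₂ _∙_ (∑-above Y (λ Z → h (false ∷ Z))) (∑-above Y (λ Z → h (true ∷ Z))))
             (sym (∑-allSubsets-suc {cosize Y} _)))
  ∑-above {N.suc n} (true ∷ Y) h =
    trans (∑-allSubsets-suc {n} _)
      (trans (cong₂ _∙_ (∑-zero (λ _ → refl) (allSubsets n)) (∑-above Y (λ Z → h (true ∷ Z))))
             (identityˡ _))

  over-lift : ∀ {n} (Y : Subset n) (R' : Coll (cosize Y)) (h : Subset n → M) →
    over (lift Y R') h ≡ over R' (λ X → h (expand Y X))
  over-lift {n} Y R' h =
    trans (∑-cong (λ Z → if-∧ (Y ⊆ᵇ Z) (R' (compress Y Z)) (h Z) ε) (allSubsets n))
      (trans (∑-above Y (λ Z → if R' (compress Y Z) then h Z else ε))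
             (∑-cong (λ X → cong (λ V → if R' V then h (expand Y X) else ε) (compress-expand Y X))
                     (allSubsets (cosize Y))))

  over-partition : ∀ {n} (R Q : Coll n) (h : Subset n → M) → UniquelyRefines R Q →
    over R h ≡ over Q (λ W → over (restrict R W) h)
  over-partition {n} R Q h unique = sym (begin
    over Q (λ W → over (restrict R W) h) ≡⟨ ∑-cong blocks A ⟩
    ∑ (λ W → ∑ (g W) A) A               ≡⟨ ∑-swap g A A ⟩
    ∑ (λ Z → ∑ (λ W → g W Z) A) A       ≡⟨ ∑-cong collect A ⟩
    over R h                             ∎)
    where
    open ≡-Reasoning
    A = allSubsets n
    g : Subset n → Subset n → M
    g W Z = if Q W ∧ W ⊆ᵇ Z then (if R Z then h Z else ε) else ε
    blocks : ∀ W → (if Q W then over (restrict R W) h else ε) ≡ ∑ (g W) A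
    blocks W with Q W
    ... | true = ∑-cong (λ Z → trans (if-∧ (R Z) (W ⊆ᵇ Z) (h Z) ε) (swap-if (R Z) (W ⊆ᵇ Z) (h Z))) A
      where
      swap-if : ∀ b c x → (if b then (if c then x else ε) else ε) ≡ (if c then (if b then x else ε) else ε)
      swap-if true c x = refl
      swap-if false true x = refl
      swap-if false false x = refl
    ... | false = sym (∑-zero (λ Z → refl) A)
    collect : ∀ Z → ∑ (λ W → g W Z) A ≡ (if R Z then h Z else ε)
    collect Z with R Z in Z∈R
    ... | false = ∑-zero (λ W → vanish (Q W ∧ W ⊆ᵇ Z)) A
      where
      vanish : ∀ b → (if b then ε else ε) ≡ ε
      vanish true = refl
      vanish false = refl
    ... | true with unique Z Z∈R
    ...   | W₀ , W₀∈Q , W₀⊆Z , only =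
      trans (∑-single (λ W → if Q W ∧ W ⊆ᵇ Z then h Z else ε) W₀ others)
            (if-cong (h Z) ε (∧-true⁺ W₀∈Q (⊆ᵇ-complete W₀⊆Z)))
      where
      others : ∀ W → W ≢ W₀ → (if Q W ∧ W ⊆ᵇ Z then h Z else ε) ≡ ε
      others W W≢W₀ with Q W ∧ W ⊆ᵇ Z in e
      ... | true = ⊥-elim (W≢W₀ (only W (∧-true⁻ˡ e) (⊆ᵇ-sound (∧-true⁻ʳ {Q W} e))))
      ... | false = refl

module ℤSum = FiniteSum Z._+_ Z.0ℤ ZP.+-identityˡ ZP.+-identityʳ ZP.+-assoc ZP.+-comm
module ℕSum = FiniteSum N._+_ 0 NP.+-identityˡ NP.+-identityʳ NP.+-assoc NP.+-comm
module ∩Sum {n : ℕ} = FiniteSum (_∩_ {n}) ⊤ SP.∩-identityˡ SP.∩-identityʳ SP.∩-assoc SP.∩-comm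

allSubsets-complete : ∀ {n} (X : Subset n) → X ∈ allSubsets n
allSubsets-complete [] = here refl
allSubsets-complete {N.suc n} (false ∷ X) = MP.∈-++⁺ˡ (MP.∈-map⁺ (false ∷_) (allSubsets-complete X))
allSubsets-complete {N.suc n} (true ∷ X) =
  MP.∈-++⁺ʳ (map (false ∷_) (allSubsets n)) (MP.∈-map⁺ (true ∷_) (allSubsets-complete X))

any? : ∀ {n} → (Subset n → Bool) → Bool
any? P = does (SP.anySubset? (λ X → P X BP.≟ true))

any?-intro : ∀ {n} (P : Subset n → Bool) X → P X ≡ true → any? P ≡ true
any?-intro P X PX = dec-true (SP.anySubset? (λ X → P X BP.≟ true)) (X , PX)

any?-elim : ∀ {n} (P : Subset n → Bool) → any? P ≡ true → ∃ λ X → P X ≡ true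
any?-elim P e with SP.anySubset? (λ X → P X BP.≟ true)
... | yes witness = witness

any?-none : ∀ {n} (P : Subset n → Bool) → any? P ≡ false → ∀ X → P X ≡ false
any?-none P e X = BP.¬-not (λ PX → false≢true (trans (sym e) (any?-intro P X PX)))

find : ∀ {n} (P : Subset n → Bool) → (∃ λ X → P X ≡ true) ⊎ (∀ X → P X ≡ false)
find P with any? P in e
... | true = inj₁ (any?-elim P e)
... | false = inj₂ (any?-none P e)

0<i-j⇒j<i : ∀ {i j} → Z.0ℤ Z.< i Z.- j → j Z.< i
0<i-j⇒j<i {i} {j} 0<i-j = subst₂ Z._<_ (ZP.+-identityˡ j) (cancel i j) (ZP.+-monoˡ-< j 0<i-j)
  where
  cancel : ∀ i j → (i Z.- j) Z.+ j ≡ i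
  cancel = solve-∀

codim-positive : ∀ {n} d (X : Subset n) → ∣ X ∣ ≤ d → Z.0ℤ Z.< codim d X
codim-positive d X ∣X∣≤d =
  subst (Z._< codim d X) (ZP.+-inverseʳ (Z.+ ∣ X ∣)) (ZP.+-monoˡ-< (Z.- Z.+ ∣ X ∣) (Z.+<+ (N.s≤s ∣X∣≤d)))

codim-antitone : ∀ {n} d {X Y : Subset n} → ∣ X ∣ ≤ ∣ Y ∣ → codim d Y Z.≤ codim d X
codim-antitone d ∣X∣≤∣Y∣ = ZP.+-mono-≤ (ZP.≤-refl {Z.+ N.suc d}) (ZP.neg-mono-≤ (Z.+≤+ ∣X∣≤∣Y∣))

codim-injective : ∀ {n} d {X Y : Subset n} → codim d X ≡ codim d Y → ∣ X ∣ ≡ ∣ Y ∣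
codim-injective d {X} {Y} e =
  ZP.+-injective (trans (sym (back (Z.+ N.suc d) (Z.+ ∣ X ∣)))
    (trans (cong (λ w → Z.+ N.suc d Z.- w) e) (back (Z.+ N.suc d) (Z.+ ∣ Y ∣))))
  where
  back : ∀ a x → a Z.- (a Z.- x) ≡ x
  back = solve-∀

DPositive : ∀ {n} → ℕ → Coll n → Set
DPositive {n} d R = ∀ (T' : Coll n) → T' ⊆ᶜ R → 1 N.< size T' → Z.0ℤ Z.< D d T'

Bounded : ∀ {n} → ℕ → Coll n → Set
Bounded d R = ∀ X → R X ≡ true → ∣ X ∣ ≤ d

DPositive-⊆ : ∀ {n} d {R R' : Coll n} → R ⊆ᶜ R' → DPositive d R' → DPositive d R
DPositive-⊆ d R⊆R' hR' T' T'⊆R = hR' T' (λ X e → R⊆R' X (T'⊆R X e))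

restrict-⊆ : ∀ {n} (R : Coll n) W → restrict R W ⊆ᶜ R
restrict-⊆ R W X e = ∧-true⁻ˡ e

restrict-above : ∀ {n} (R : Coll n) W Z → restrict R W Z ≡ true → W ⊆ Z
restrict-above R W Z e = ⊆ᵇ-sound (∧-true⁻ʳ {R Z} e)

⋂-as-sum : ∀ {n} (R : Coll n) → ⋂ R ≡ ∩Sum.over R (λ Z → Z)
⋂-as-sum {n} R = along (allSubsets n)
  where
  along : ∀ l → foldr (λ X acc → if R X then X ∩ acc else acc) ⊤ l ≡ ∩Sum.∑ (λ Z → if R Z then Z else ⊤) l
  along [] = refl
  along (X ∷ l) with R X
  ... | true = cong (X ∩_) (along l)
  ... | false = trans (along l) (sym (SP.∩-identityˡ _))

size-as-sum : ∀ {n} (R : Coll n) → size R ≡ ℕSum.over R (λ _ → 1)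
size-as-sum {n} R = along (allSubsets n)
  where
  along : ∀ l → length (filterᵇ R l) ≡ ℕSum.∑ (λ Z → if R Z then 1 else 0) l
  along [] = refl
  along (X ∷ l) with R X
  ... | true = cong N.suc (along l)
  ... | false = along l

ρ-cong : ∀ {n} d {R R' : Coll n} → R ≐ R' → ρ d R ≡ ρ d R'
ρ-cong d = ℤSum.over-cong (codim d)

⋂-cong : ∀ {n} {R R' : Coll n} → R ≐ R' → ⋂ R ≡ ⋂ R'
⋂-cong {R = R} {R'} R≐R' = trans (⋂-as-sum R) (trans (∩Sum.over-cong (λ Z → Z) R≐R') (sym (⋂-as-sum R')))

size-cong : ∀ {n} {R R' : Coll n} → R ≐ R' → size R ≡ size R'
size-cong {R = R} {R'} R≐R' = trans (size-as-sum R) (trans (ℕSum.over-cong _ R≐R') (sym (size-as-sum R')))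

D-cong : ∀ {n} d {R R' : Coll n} → R ≐ R' → D d R ≡ D d R'
D-cong d R≐R' = cong₂ (λ a b → codim d a Z.- b) (⋂-cong R≐R') (ρ-cong d R≐R')

size-∅ : ∀ {n} {R : Coll n} → (∀ Z → R Z ≡ false) → size R ≡ 0
size-∅ {R = R} none = trans (size-as-sum R) (ℕSum.over-∅ _ none)

⋂-｛｝ : ∀ {n} {R : Coll n} {X} → R ≐ ｛ X ｝ → ⋂ R ≡ X
⋂-｛｝ {R = R} R≐X = trans (⋂-as-sum R) (∩Sum.over-｛｝ (λ Z → Z) R≐X)

⋂-greatest : ∀ {n} (R : Coll n) (W : Subset n) → (∀ Z → R Z ≡ true → W ⊆ Z) → W ⊆ ⋂ R
⋂-greatest {n} R W below = subst (W ⊆_) (sym (⋂-as-sum R)) (along (allSubsets n))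
  where
  along : ∀ l → W ⊆ ∩Sum.∑ (λ Z → if R Z then Z else ⊤) l
  along [] = SP.⊆⊤
  along (X ∷ l) with R X in X∈R
  ... | true = ∩-glb (below X X∈R) (along l)
  ... | false = ∩-glb SP.⊆⊤ (along l)

size>1 : ∀ {n} (R : Coll n) {X Y} → R X ≡ true → R Y ≡ true → X ≢ Y → 1 N.< size R
size>1 {n} R {X} {Y} RX RY X≢Y =
  two (allSubsets n) (allSubsets-complete X) (allSubsets-complete Y) X≢Y RX RY
  where
  one : ∀ {x} l → x ∈ l → R x ≡ true → 1 ≤ length (filterᵇ R l)
  one (y ∷ l) (here refl) Rx rewrite Rx = N.s≤s N.z≤n
  one (y ∷ l) (there x∈l) Rx with R y
  ... | true = N.s≤s N.z≤n
  ... | false = one l x∈l Rx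
  two : ∀ {x y} l → x ∈ l → y ∈ l → x ≢ y → R x ≡ true → R y ≡ true → 2 ≤ length (filterᵇ R l)
  two (z ∷ l) (here refl) (here refl) x≢y _ _ = ⊥-elim (x≢y refl)
  two (z ∷ l) (here refl) (there y∈l) _ Rx Ry rewrite Rx = N.s≤s (one l y∈l Ry)
  two (z ∷ l) (there x∈l) (here refl) _ Rx Ry rewrite Ry = N.s≤s (one l x∈l Rx)
  two (z ∷ l) (there x∈l) (there y∈l) x≢y Rx Ry with R z
  ... | true = N.s≤s (one l x∈l Rx)
  ... | false = two l x∈l y∈l x≢y Rx Ry

data Shape {n} (R : Coll n) : Set where
  empty : (∀ Z → R Z ≡ false) → Shape R
  singleton : ∀ X → R ≐ ｛ X ｝ → Shape R
  two-members : ∀ X Y → R X ≡ true → R Y ≡ true → X ≢ Y → Shape R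

shape : ∀ {n} (R : Coll n) → Shape R
shape R with find R
... | inj₂ none = empty none
... | inj₁ (X , RX) with find (λ Z → R Z ∧ not (｛ X ｝ Z))
...   | inj₁ (Y , e) = two-members X Y RX (∧-true⁻ˡ e) X≢Y
  where
  X≢Y : X ≢ Y
  X≢Y refl = false≢true (trans (cong not (sym (｛｝-refl X))) (∧-true⁻ʳ {R X} e))
...   | inj₂ none = singleton X R≐X
  where
  R≐X : R ≐ ｛ X ｝
  R≐X Z with ｛ X ｝ Z in e
  ... | true = subst (λ W → R W ≡ true) (sym (｛｝-member e)) RX
  ... | false = trans (sym (BP.∧-identityʳ (R Z))) (subst (λ b → R Z ∧ not b ≡ false) e (none Z))

∑-mono : ∀ {A : Set} {a b : A → Z.ℤ} → (∀ x → a x Z.≤ b x) → ∀ l → ℤSum.∑ a l Z.≤ ℤSum.∑ b l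
∑-mono a≤b [] = ZP.≤-refl
∑-mono a≤b (x ∷ l) = ZP.+-mono-≤ (a≤b x) (∑-mono a≤b l)

∑-tight : ∀ {A : Set} {a b : A → Z.ℤ} → (∀ x → a x Z.≤ b x) → ∀ l → ℤSum.∑ a l ≡ ℤSum.∑ b l →
  ∀ x → x ∈ l → a x ≡ b x
∑-tight {a = a} {b} a≤b (y ∷ l) e x x∈ with a y ZP.≟ b y
... | no ay≢by = ⊥-elim (ZP.<-irrefl e (ZP.+-mono-<-≤ (ZP.≤∧≢⇒< (a≤b y) ay≢by) (∑-mono a≤b l)))
∑-tight a≤b (y ∷ l) e x (here refl) | yes ay≡by = ay≡by
∑-tight {a = a} {b} a≤b (y ∷ l) e x (there x∈l) | yes ay≡by =
  ∑-tight a≤b l (∙-cancelˡ (a y) _ _ (trans e (cong (Z._+ ℤSum.∑ b l) (sym ay≡by)))) x x∈l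

-- For a nonempty D-positive P, ρ(P) ≤ codim(⋂P) (equality for singletons, D(P) > 0 otherwise).
ρ≤codim⋂ : ∀ {n} d (P : Coll n) {Z} → DPositive d P → P Z ≡ true → ρ d P Z.≤ codim d (⋂ P)
ρ≤codim⋂ d P hP PZ with shape P
... | empty none = false≢true (trans (sym (none _)) PZ)
... | singleton X P≐X = ZP.≤-reflexive (trans (ℤSum.over-｛｝ (codim d) P≐X) (cong (codim d) (sym (⋂-｛｝ P≐X))))
... | two-members X Y PX PY X≢Y = ZP.<⇒≤ (0<i-j⇒j<i (hP P (λ _ e → e) (size>1 P PX PY X≢Y)))

ρ≤codim-below : ∀ {n} d (P : Coll n) (W : Subset n) → DPositive d P → (∀ Z → P Z ≡ true → W ⊆ Z) →
  ∣ W ∣ ≤ d → (ρ d P Z.≤ codim d W) × (ρ d P ≡ codim d W → P ≐ ｛ W ｝)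
ρ≤codim-below d P W hP below ∣W∣≤d with shape P
... | empty none = ZP.<⇒≤ ρ<codim , λ e → ⊥-elim (ZP.<-irrefl e ρ<codim)
  where
  ρ<codim : ρ d P Z.< codim d W
  ρ<codim = subst (Z._< codim d W) (sym (ℤSum.over-∅ (codim d) none)) (codim-positive d W ∣W∣≤d)
... | singleton X P≐X = ρ≤ , ρ≡⇒P≐W
  where
  ρP≡ : ρ d P ≡ codim d X
  ρP≡ = ℤSum.over-｛｝ (codim d) P≐X
  W⊆X : W ⊆ X
  W⊆X = below X (trans (P≐X X) (｛｝-refl X))
  ρ≤ : ρ d P Z.≤ codim d W
  ρ≤ = subst (Z._≤ codim d W) (sym ρP≡) (codim-antitone d {X = W} {Y = X} (SP.p⊆q⇒∣p∣≤∣q∣ W⊆X))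
  ρ≡⇒P≐W : ρ d P ≡ codim d W → P ≐ ｛ W ｝
  ρ≡⇒P≐W e Z = trans (P≐X Z) (cong (λ V → ｛ V ｝ Z) (sym W≡X))
    where
    W≡X : W ≡ X
    W≡X = ⊆-card-≡ W⊆X (sym (codim-injective d {X = X} {Y = W} (trans (sym ρP≡) e)))
... | two-members X Y PX PY X≢Y = ZP.<⇒≤ ρ<codim , λ e → ⊥-elim (ZP.<-irrefl e ρ<codim)
  where
  ρ<codim : ρ d P Z.< codim d W
  ρ<codim = ZP.<-≤-trans (0<i-j⇒j<i (hP P (λ _ e → e) (size>1 P PX PY X≢Y)))
              (codim-antitone d {X = W} {Y = ⋂ P} (SP.p⊆q⇒∣p∣≤∣q∣ (⋂-greatest P W below)))

-- Two distinct members Y, Y' of a D-positive collection never lie in a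
-- common set Z of size ≤ d: D({Y,Y'}) > 0 says |Y ∪ Y'| > d + 1.
unique-below : ∀ {n} d (S : Coll n) → DPositive d S → ∀ {Z Y Y'} → ∣ Z ∣ ≤ d →
  S Y ≡ true → S Y' ≡ true → Y ⊆ Z → Y' ⊆ Z → Y ≡ Y'
unique-below d S hS {Z} {Y} {Y'} ∣Z∣≤d SY SY' Y⊆Z Y'⊆Z with VP.≡-dec BP._≟_ Y Y'
... | yes Y≡Y' = Y≡Y'
... | no Y≢Y' = ⊥-elim (NP.<-irrefl refl (NP.<-≤-trans union-large union-small))
  where
  i = ∣ Y ∩ Y' ∣
  pair⊆S : pair Y Y' ⊆ᶜ S
  pair⊆S X e with ｛ Y ｝ X in eY
  ... | true = subst (λ V → S V ≡ true) (sym (｛｝-member eY)) SY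
  ... | false = subst (λ V → S V ≡ true) (sym (｛｝-member e)) SY'
  pairY : pair Y Y' Y ≡ true
  pairY rewrite ｛｝-refl Y = refl
  pairY' : pair Y Y' Y' ≡ true
  pairY' rewrite ｛｝-refl Y' = BP.∨-zeroʳ _
  D-pair : D d (pair Y Y') ≡ Z.+ (∣ Y ∣ N.+ ∣ Y' ∣) Z.- Z.+ (N.suc d N.+ i)
  D-pair = begin
    codim d (⋂ (pair Y Y')) Z.- ρ d (pair Y Y')
      ≡⟨ cong₂ (λ a b → codim d a Z.- b) (trans (⋂-as-sum (pair Y Y')) (∩Sum.over-pair (λ Z → Z) Y≢Y'))
                                        (ℤSum.over-pair (codim d) Y≢Y') ⟩
    codim d (Y ∩ Y') Z.- (codim d Y Z.+ codim d Y')
      ≡⟨ rearrange (Z.+ N.suc d) (Z.+ i) (Z.+ ∣ Y ∣) (Z.+ ∣ Y' ∣) ⟩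
    (Z.+ ∣ Y ∣ Z.+ Z.+ ∣ Y' ∣) Z.- (Z.+ N.suc d Z.+ Z.+ i)
      ≡⟨ sym (cong₂ Z._-_ (ZP.pos-+ ∣ Y ∣ ∣ Y' ∣) (ZP.pos-+ (N.suc d) i)) ⟩
    Z.+ (∣ Y ∣ N.+ ∣ Y' ∣) Z.- Z.+ (N.suc d N.+ i) ∎
    where
    open ≡-Reasoning
    rearrange : ∀ c i y y' → (c Z.- i) Z.- ((c Z.- y) Z.+ (c Z.- y')) ≡ (y Z.+ y') Z.- (c Z.+ i)
    rearrange = solve-∀
  union-large : N.suc d N.+ i N.< ∣ Y ∣ N.+ ∣ Y' ∣
  union-large = ZP.drop‿+<+ (0<i-j⇒j<i (subst (Z.0ℤ Z.<_) D-pair (hS (pair Y Y') pair⊆S (size>1 _ pairY pairY' Y≢Y'))))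
  union-small : ∣ Y ∣ N.+ ∣ Y' ∣ ≤ N.suc d N.+ i
  union-small = begin
    ∣ Y ∣ N.+ ∣ Y' ∣      ≡⟨ ∣∩∣+∣∪∣ Y Y' ⟩
    i N.+ ∣ Y ∪ Y' ∣      ≤⟨ NP.+-monoʳ-≤ i (NP.≤-trans (SP.p⊆q⇒∣p∣≤∣q∣ (∪-lub Y⊆Z Y'⊆Z)) ∣Z∣≤d) ⟩
    i N.+ d               ≡⟨ NP.+-comm i d ⟩
    d N.+ i               ≤⟨ NP.n≤1+n _ ⟩
    N.suc d N.+ i         ∎
    where open NP.≤-Reasoning

≤⇒refines : ∀ {n} d {R Q : Coll n} → R ≤[ d ] Q → Refines R Q
≤⇒refines d (inj₁ (_ , R-refines-Q)) = R-refines-Q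
≤⇒refines d (inj₂ R≐Q) Z RZ = Z , trans (sym (R≐Q Z)) RZ , SP.⊆-refl

≤-resp-≐ : ∀ {n} d {R₁ R₁' R₂ R₂' : Coll n} → R₁ ≐ R₁' → R₂ ≐ R₂' → R₁ ≤[ d ] R₂ → R₁' ≤[ d ] R₂'
≤-resp-≐ d R₁≐ R₂≐ (inj₁ (ρ< , refines)) =
  inj₁ (subst₂ Z._<_ (ρ-cong d R₁≐) (ρ-cong d R₂≐) ρ< ,
        λ X e → let (W , R₂W , W⊆X) = refines X (trans (R₁≐ X) e) in W , trans (sym (R₂≐ W)) R₂W , W⊆X)
≤-resp-≐ d R₁≐ R₂≐ (inj₂ R₁≐R₂) = inj₂ (λ Z → trans (sym (R₁≐ Z)) (trans (R₁≐R₂ Z) (R₂≐ Z)))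

refines-uniquely : ∀ {n} d {R Q : Coll n} → DPositive d Q → Bounded d R → Refines R Q → UniquelyRefines R Q
refines-uniquely d {R} {Q} hQ bR refines Z RZ with refines Z RZ
... | W , QW , W⊆Z = W , QW , W⊆Z , λ W' QW' W'⊆Z → unique-below d Q hQ (bR Z RZ) QW' QW W'⊆Z W⊆Z

refines-｛｝ : ∀ {n} {R : Coll n} {W} → (∀ Z → R Z ≡ true → W ⊆ Z) → UniquelyRefines R ｛ W ｝
refines-｛｝ {W = W} above Z RZ = W , ｛｝-refl W , above Z RZ , λ W' e _ → ｛｝-member {X = W} {Y = W'} e

blocks-trivial : ∀ {n} {R Q : Coll n} → Refines R Q → (∀ W → Q W ≡ true → restrict R W ≐ ｛ W ｝) → R ≐ Q
blocks-trivial {R = R} {Q} refines trivial Z with R Z in RZ | Q Z in QZ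
... | true | true = refl
... | false | false = refl
... | true | false with refines Z RZ
...   | W , QW , W⊆Z = false≢true (trans (sym QZ) (subst (λ V → Q V ≡ true) (sym Z≡W) QW))
  where
  Z≡W : Z ≡ W
  Z≡W = ｛｝-member {X = W} {Y = Z} (trans (sym (trivial W QW Z)) (∧-true⁺ RZ (⊆ᵇ-complete W⊆Z)))
blocks-trivial {R = R} {Q} refines trivial Z | false | true =
  false≢true (trans (sym RZ) (∧-true⁻ˡ (trans (trivial Z QZ Z) (｛｝-refl Z))))

-- Splitting R into the blocks R_W (W ∈ Q),
-- ρ(R) = Σ_W ρ(R_W) ≤ Σ_W codim(W) = ρ(Q); equality forces R_W = {W} for
-- every W, i.e. R = Q.
comparison : ∀ {n} d {R Q : Coll n} → DPositive d R → Bounded d Q → UniquelyRefines R Q → R ≤[ d ] Q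
comparison {n} d {R} {Q} hR bQ unique = decide (ρ d R ZP.≟ ρ d Q)
  where
  A = allSubsets n
  refines : Refines R Q
  refines Z RZ = let (W , QW , W⊆Z , _) = unique Z RZ in W , QW , W⊆Z
  block : ∀ W → Q W ≡ true → (ρ d (restrict R W) Z.≤ codim d W) × (ρ d (restrict R W) ≡ codim d W → restrict R W ≐ ｛ W ｝)
  block W QW = ρ≤codim-below d (restrict R W) W (DPositive-⊆ d (restrict-⊆ R W) hR) (restrict-above R W) (bQ W QW)
  blockρ codimQ : Subset n → Z.ℤ
  blockρ W = if Q W then ρ d (restrict R W) else Z.0ℤ
  codimQ W = if Q W then codim d W else Z.0ℤ
  termwise : ∀ W → blockρ W Z.≤ codimQ W
  termwise W with Q W in QW
  ... | true = proj₁ (block W QW)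
  ... | false = ZP.≤-refl
  ρ-blocks : ρ d R ≡ ℤSum.∑ blockρ A
  ρ-blocks = ℤSum.over-partition R Q (codim d) unique
  ρR≤ρQ : ρ d R Z.≤ ρ d Q
  ρR≤ρQ = subst (Z._≤ ρ d Q) (sym ρ-blocks) (∑-mono termwise A)
  blocks-tight : ρ d R ≡ ρ d Q → ∀ W → Q W ≡ true → restrict R W ≐ ｛ W ｝
  blocks-tight ρR≡ρQ W QW = proj₂ (block W QW) (begin
    ρ d (restrict R W) ≡⟨ sym (if-cong _ Z.0ℤ QW) ⟩
    blockρ W           ≡⟨ ∑-tight termwise A (trans (sym ρ-blocks) ρR≡ρQ) W (allSubsets-complete W) ⟩
    codimQ W           ≡⟨ if-cong _ Z.0ℤ QW ⟩
    codim d W          ∎)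
    where open ≡-Reasoning
  decide : Dec (ρ d R ≡ ρ d Q) → R ≤[ d ] Q
  decide (no ρR≢ρQ) = inj₁ (ZP.≤∧≢⇒< ρR≤ρQ ρR≢ρQ , refines)
  decide (yes ρR≡ρQ) = inj₂ (blocks-trivial refines (blocks-tight ρR≡ρQ))

-- For a collection J and sets A(Y) ⊇ Y
-- attached to its members, the excess Σ_{Y∈J} codim(A Y) − codim(⋂_{Y∈J} A Y)
-- is at most the excess ρ(J) − codim(⋂J) of J itself: adding one member
-- at a time, this is ∣∪∣-mono for Y ⊆ A(Y) and the intersections so far.

⋂ᶠ : ∀ {n} (J : Coll n) (A : Subset n → Subset n) → List (Subset n) → Subset n
⋂ᶠ J A l = ∩Sum.∑ (λ Y → if J Y then A Y else ⊤) l

excess : ∀ {n} d (J : Coll n) (A : Subset n → Subset n) → List (Subset n) → Z.ℤ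
excess d J A l = ℤSum.∑ (λ Y → if J Y then codim d (A Y) else Z.0ℤ) l Z.- codim d (⋂ᶠ J A l)

excess-step : ∀ K sA sY a ia x y iy z → sA Z.- (K Z.- ia) Z.≤ sY Z.- (K Z.- iy) →
  y Z.+ iy Z.+ x Z.≤ a Z.+ ia Z.+ z →
  ((K Z.- a) Z.+ sA) Z.- (K Z.- x) Z.≤ ((K Z.- y) Z.+ sY) Z.- (K Z.- z)
excess-step K sA sY a ia x y iy z ih sub =
  subst₂ Z._≤_ (shift K sA a ia x y iy) (shift' K sY a ia y iy z)
    (ZP.+-monoˡ-≤ (Z.- (Z.- K Z.+ ia Z.+ y Z.+ iy Z.+ a)) (ZP.+-mono-≤ ih sub))
  where
  shift : ∀ K sA a ia x y iy → (sA Z.- (K Z.- ia) Z.+ (y Z.+ iy Z.+ x)) Z.+ Z.- (Z.- K Z.+ ia Z.+ y Z.+ iy Z.+ a)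
          ≡ ((K Z.- a) Z.+ sA) Z.- (K Z.- x)
  shift = solve-∀
  shift' : ∀ K sY a ia y iy z → (sY Z.- (K Z.- iy) Z.+ (a Z.+ ia Z.+ z)) Z.+ Z.- (Z.- K Z.+ ia Z.+ y Z.+ iy Z.+ a)
          ≡ ((K Z.- y) Z.+ sY) Z.- (K Z.- z)
  shift' = solve-∀

excess-antitone : ∀ {n} d (J : Coll n) (A : Subset n → Subset n) → (∀ Y → J Y ≡ true → Y ⊆ A Y) → ∀ l →
  ⋂ᶠ J (λ Y → Y) l ⊆ ⋂ᶠ J A l × excess d J A l Z.≤ excess d J (λ Y → Y) l
excess-antitone d J A grow [] = SP.⊆-refl , ZP.≤-refl
excess-antitone d J A grow (Y ∷ l) with J Y in JY | excess-antitone d J A grow l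
... | false | ⋂⊆ , ih
  rewrite SP.∩-identityˡ (⋂ᶠ J (λ Y → Y) l) | SP.∩-identityˡ (⋂ᶠ J A l)
        | ZP.+-identityˡ (ℤSum.∑ (λ Y → if J Y then codim d (A Y) else Z.0ℤ) l)
        | ZP.+-identityˡ (ℤSum.∑ (λ Y → if J Y then codim d Y else Z.0ℤ) l) = ⋂⊆ , ih
... | true | ⋂⊆ , ih =
  ∩-mono (grow Y JY) ⋂⊆ ,
  excess-step (Z.+ N.suc d) _ _ (Z.+ ∣ A Y ∣) (Z.+ ∣ IA ∣) (Z.+ ∣ A Y ∩ IA ∣) (Z.+ ∣ Y ∣) (Z.+ ∣ IY ∣) (Z.+ ∣ Y ∩ IY ∣)
    ih (subst₂ Z._≤_ (pos-+₃ (∣ Y ∣) (∣ IY ∣) (∣ A Y ∩ IA ∣)) (pos-+₃ (∣ A Y ∣) (∣ IA ∣) (∣ Y ∩ IY ∣))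
          (Z.+≤+ (∣∪∣-mono (grow Y JY) ⋂⊆)))
  where
  IA = ⋂ᶠ J A l
  IY = ⋂ᶠ J (λ Y → Y) l
  pos-+₃ : ∀ p q r → Z.+ (p N.+ q N.+ r) ≡ Z.+ p Z.+ Z.+ q Z.+ Z.+ r
  pos-+₃ p q r = trans (ZP.pos-+ (p N.+ q) r) (cong (Z._+ Z.+ r) (ZP.pos-+ p q))

minus-swap : ∀ {a b c e} → a Z.- b Z.≤ c Z.- e → e Z.- c Z.≤ b Z.- a
minus-swap {a} {b} {c} {e} h = subst₂ Z._≤_ (negate c e) (negate a b) (ZP.neg-mono-≤ h)
  where
  negate : ∀ p q → Z.- (p Z.- q) ≡ q Z.- p
  negate = solve-∀

-- For U ⊆ G with |U| > 1 let J ⊆ T be the members of T below some member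
-- of U, and A(Y) = ⋂U_Y ⊇ Y.  If J = {Y}, U lies in the block G_Y.
-- Otherwise ρ(U) ≤ Σ_{Y∈J} codim(A Y) (ρ≤codim⋂ on each block) and
-- ⋂U = ⋂_{Y∈J} A(Y), so excess-antitone gives 0 < D(J) ≤ D(U).
module Gluing {n} d (T G : Coll n) (hT : DPositive d T) (unique : UniquelyRefines G T)
  (blocks : ∀ Y → T Y ≡ true → DPositive d (restrict G Y)) (U : Coll n) (U⊆G : U ⊆ᶜ G) where

  J : Coll n
  J Y = T Y ∧ any? (restrict U Y)

  A : Subset n → Subset n
  A Y = ⋂ (restrict U Y)

  uniqueU : UniquelyRefines U T
  uniqueU Z UZ = unique Z (U⊆G Z UZ)

  J-below : ∀ Z → U Z ≡ true → ∃ λ Y → J Y ≡ true × Y ⊆ Z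
  J-below Z UZ with uniqueU Z UZ
  ... | Y , TY , Y⊆Z , _ = Y , ∧-true⁺ TY (any?-intro (restrict U Y) Z (∧-true⁺ UZ (⊆ᵇ-complete Y⊆Z))) , Y⊆Z

  U_Y-positive : ∀ Y → T Y ≡ true → DPositive d (restrict U Y)
  U_Y-positive Y TY = DPositive-⊆ d (λ Z e → ∧-true⁺ (U⊆G Z (∧-true⁻ˡ e)) (∧-true⁻ʳ {U Z} e)) (blocks Y TY)

  ρU≤ : ρ d U Z.≤ ℤSum.over J (λ Y → codim d (A Y))
  ρU≤ = subst (Z._≤ ℤSum.over J (λ Y → codim d (A Y))) (sym (ℤSum.over-partition U T (codim d) uniqueU)) (∑-mono termwise (allSubsets n))
    where
    termwise : ∀ Y → (if T Y then ρ d (restrict U Y) else Z.0ℤ) Z.≤ (if J Y then codim d (A Y) else Z.0ℤ)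
    termwise Y with T Y in TY
    ... | false = ZP.≤-refl
    ... | true with any? (restrict U Y) in e
    ...   | true = ρ≤codim⋂ d (restrict U Y) (U_Y-positive Y TY) (proj₂ (any?-elim (restrict U Y) e))
    ...   | false = ZP.≤-reflexive (ℤSum.over-∅ (codim d) (any?-none (restrict U Y) e))

  ⋂U≡ : ⋂ U ≡ ⋂ᶠ J A (allSubsets n)
  ⋂U≡ = trans (⋂-as-sum U) (trans (∩Sum.over-partition U T (λ Z → Z) uniqueU) (∩Sum.∑-cong termwise (allSubsets n)))
    where
    termwise : ∀ Y → (if T Y then ∩Sum.over (restrict U Y) (λ Z → Z) else ⊤) ≡ (if J Y then A Y else ⊤)
    termwise Y with T Y
    ... | false = refl
    ... | true with any? (restrict U Y) in e
    ...   | true = sym (⋂-as-sum (restrict U Y))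
    ...   | false = ∩Sum.over-∅ (λ Z → Z) (any?-none (restrict U Y) e)

  D-grows : D d J Z.≤ D d U
  D-grows = minus-swap {ρ d U} {codim d (⋂ U)} {ρ d J} {codim d (⋂ J)} (begin
    ρ d U Z.- codim d (⋂ U)                                ≤⟨ ZP.+-monoˡ-≤ _ ρU≤ ⟩
    ℤSum.over J (λ Y → codim d (A Y)) Z.- codim d (⋂ U)    ≡⟨ cong (λ V → ℤSum.over J (λ Y → codim d (A Y)) Z.- codim d V) ⋂U≡ ⟩
    excess d J A (allSubsets n)                            ≤⟨ proj₂ (excess-antitone d J A A⊇ (allSubsets n)) ⟩
    excess d J (λ Y → Y) (allSubsets n)                    ≡⟨ cong (λ V → ρ d J Z.- codim d V) (sym (⋂-as-sum J)) ⟩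
    ρ d J Z.- codim d (⋂ J)                                ∎)
    where
    open ZP.≤-Reasoning
    A⊇ : ∀ Y → J Y ≡ true → Y ⊆ A Y
    A⊇ Y _ = ⋂-greatest (restrict U Y) Y (restrict-above U Y)

  D-positive : 1 N.< size U → Z.0ℤ Z.< D d U
  D-positive |U|>1 with shape J
  ... | empty none = ⊥-elim (NP.<⇒≱ |U|>1 (subst (N._≤ 1) (sym (size-∅ U-empty)) N.z≤n))
    where
    U-empty : ∀ Z → U Z ≡ false
    U-empty Z with U Z in UZ
    ... | false = refl
    ... | true = let (Y , JY , _) = J-below Z UZ in false≢true (trans (sym (none Y)) JY)
  ... | singleton Y₁ J≐Y₁ = blocks Y₁ (∧-true⁻ˡ (trans (J≐Y₁ Y₁) (｛｝-refl Y₁))) U U⊆G_Y₁ |U|>1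
    where
    U⊆G_Y₁ : U ⊆ᶜ restrict G Y₁
    U⊆G_Y₁ Z UZ with J-below Z UZ
    ... | Y , JY , Y⊆Z =
      ∧-true⁺ (U⊆G Z UZ) (⊆ᵇ-complete (subst (_⊆ Z) (｛｝-member {X = Y₁} {Y = Y} (trans (sym (J≐Y₁ Y)) JY)) Y⊆Z))
  ... | two-members Y Y' JY JY' Y≢Y' =
    ZP.<-≤-trans (hT J (λ Y e → ∧-true⁻ˡ e) (size>1 J JY JY' Y≢Y')) D-grows

union-DPositive : ∀ {n} d (T G : Coll n) → DPositive d T → UniquelyRefines G T →
  (∀ Y → T Y ≡ true → DPositive d (restrict G Y)) → DPositive d G
union-DPositive d T G hT unique blocks U U⊆G = Gluing.D-positive d T G hT unique blocks U U⊆G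

DPositive-≐ : ∀ {n} d {R R' : Coll n} → R ≐ R' → DPositive d R' → DPositive d R
DPositive-≐ d R≐R' = DPositive-⊆ d (λ X e → trans (sym (R≐R' X)) e)

Bounded-｛｝ : ∀ {n} {d} {W : Subset n} → ∣ W ∣ ≤ d → Bounded d ｛ W ｝
Bounded-｛｝ {d = d} {W} ∣W∣≤d X e = subst (λ V → ∣ V ∣ ≤ d) (sym (｛｝-member {X = W} {Y = X} e)) ∣W∣≤d

restrict-InL : ∀ {n d} {S : Coll n} → InL n d S → ∀ W → InL n d (restrict S W)
restrict-InL {d = d} {S} (hS , bS) W = DPositive-⊆ d (restrict-⊆ S W) hS , λ Z e → bS Z (∧-true⁻ˡ e)

blocks-determine : ∀ {n} {T R R' : Coll n} → Refines R T → Refines R' T →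
  (∀ Y → T Y ≡ true → restrict R Y ≐ restrict R' Y) → R ≐ R'
blocks-determine {R = R} {R'} R-refines R'-refines same Z with R Z in RZ | R' Z in R'Z
... | true | true = refl
... | false | false = refl
... | true | false with R-refines Z RZ
...   | Y , TY , Y⊆Z = false≢true (trans (sym (cong (_∧ Y ⊆ᵇ Z) R'Z)) (trans (sym (same Y TY Z)) (∧-true⁺ RZ (⊆ᵇ-complete Y⊆Z))))
blocks-determine {R = R} {R'} R-refines R'-refines same Z | false | true with R'-refines Z R'Z
...   | Y , TY , Y⊆Z = false≢true (trans (sym (cong (_∧ Y ⊆ᵇ Z) RZ)) (trans (same Y TY Z) (∧-true⁺ R'Z (⊆ᵇ-complete Y⊆Z))))

-- Every
-- member of S ≤ T lies above exactly one member of T (unique-below), so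
-- S is the disjoint union of its blocks, and the order is checked blockwise
-- with the comparison criterion.  Conversely a family of blocks glues to
-- an element of I(T) by union-DPositive.
module BlockDecomposition {n} d (T : Coll n) (hT : DPositive d T) (bT : Bounded d T) where

  Src : Set
  Src = Pos.Carrier (Ideal n d T)

  Tgt : Set
  Tgt = Pos.Carrier (Πₚ (Mem T) (λ Ti → Ideal n d ｛ proj₁ Ti ｝))

  ⟦_⟧ : Src → Coll n
  ⟦ x ⟧ = proj₁ (proj₁ x)

  InL⟦_⟧ : (x : Src) → InL n d ⟦ x ⟧
  InL⟦ x ⟧ = proj₂ (proj₁ x)

  refines-T : (x : Src) → Refines ⟦ x ⟧ T
  refines-T x = ≤⇒refines d (proj₂ x)

  below-｛｝ : ∀ {R} Y → T Y ≡ true → DPositive d R → (∀ Z → R Z ≡ true → Y ⊆ Z) → R ≤[ d ] ｛ Y ｝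
  below-｛｝ Y TY hR above = comparison d hR (Bounded-｛｝ (bT Y TY)) (refines-｛｝ above)

  block : Src → Tgt
  block x (Y , TY) = (restrict ⟦ x ⟧ Y , restrict-InL InL⟦ x ⟧ Y) ,
    below-｛｝ Y TY (proj₁ (restrict-InL InL⟦ x ⟧ Y)) (restrict-above ⟦ x ⟧ Y)

  block-mono : ∀ {x y : Src} → ⟦ x ⟧ ≤[ d ] ⟦ y ⟧ → ∀ (i : Mem T) → restrict ⟦ x ⟧ (proj₁ i) ≤[ d ] restrict ⟦ y ⟧ (proj₁ i)
  block-mono {x} {y} x≤y (Y , TY) =
    comparison d (proj₁ (restrict-InL InL⟦ x ⟧ Y)) (proj₂ (restrict-InL InL⟦ y ⟧ Y))
      (refines-uniquely d (proj₁ (restrict-InL InL⟦ y ⟧ Y)) (proj₂ (restrict-InL InL⟦ x ⟧ Y)) refines)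
    where
    refines : Refines (restrict ⟦ x ⟧ Y) (restrict ⟦ y ⟧ Y)
    refines Z e with ≤⇒refines d x≤y Z (∧-true⁻ˡ e)
    ... | W , yW , W⊆Z with refines-T y W yW
    ...   | Y' , TY' , Y'⊆W = W , ∧-true⁺ yW (⊆ᵇ-complete (subst (_⊆ W) Y'≡Y Y'⊆W)) , W⊆Z
      where
      Y'≡Y : Y' ≡ Y
      Y'≡Y = unique-below d T hT (proj₂ InL⟦ x ⟧ Z (∧-true⁻ˡ e)) TY' TY (SP.⊆-trans Y'⊆W W⊆Z) (restrict-above ⟦ x ⟧ Y Z e)

  block-injective : ∀ {x y : Src} → (∀ (i : Mem T) → restrict ⟦ x ⟧ (proj₁ i) ≐ restrict ⟦ y ⟧ (proj₁ i)) → ⟦ x ⟧ ≐ ⟦ y ⟧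
  block-injective {x} {y} same = blocks-determine (refines-T x) (refines-T y) (λ Y TY → same (Y , TY))

  block-cancel : ∀ {x y : Src} → (∀ (i : Mem T) → restrict ⟦ x ⟧ (proj₁ i) ≤[ d ] restrict ⟦ y ⟧ (proj₁ i)) →
    ⟦ x ⟧ ≤[ d ] ⟦ y ⟧
  block-cancel {x} {y} blockwise =
    comparison d (proj₁ InL⟦ x ⟧) (proj₂ InL⟦ y ⟧) (refines-uniquely d (proj₁ InL⟦ y ⟧) (proj₂ InL⟦ x ⟧) refines)
    where
    refines : Refines ⟦ x ⟧ ⟦ y ⟧
    refines Z xZ with refines-T x Z xZ
    ... | Y , TY , Y⊆Z with ≤⇒refines d (blockwise (Y , TY)) Z (∧-true⁺ xZ (⊆ᵇ-complete Y⊆Z))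
    ...   | W , e , W⊆Z = W , ∧-true⁻ˡ e , W⊆Z

  module Glue (σ : Tgt) where

    σ⟨_⟩ : Mem T → Coll n
    σ⟨ i ⟩ = proj₁ (proj₁ (σ i))

    σ-InL : ∀ i → InL n d σ⟨ i ⟩
    σ-InL i = proj₂ (proj₁ (σ i))

    σ-above : ∀ i Z → σ⟨ i ⟩ Z ≡ true → proj₁ i ⊆ Z
    σ-above i Z e with ≤⇒refines d (proj₂ (σ i)) Z e
    ... | W , W∈ , W⊆Z = subst (_⊆ Z) (｛｝-member {X = proj₁ i} {Y = W} W∈) W⊆Z

    blockAt : (Y : Subset n) (b : Bool) → T Y ≡ b → Coll n
    blockAt Y true TY = σ⟨ Y , TY ⟩
    blockAt Y false _ = ∅ᶜ

    blockAt-spec : ∀ Y b (e : T Y ≡ b) (TY : T Y ≡ true) → blockAt Y b e ≐ σ⟨ Y , TY ⟩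
    blockAt-spec Y true e TY Z = cong (λ p → σ⟨ Y , p ⟩ Z) (bool-irrelevant e TY)
    blockAt-spec Y false e TY Z = false≢true (trans (sym e) TY)

    blockAt-member : ∀ Y b (e : T Y ≡ b) Z → blockAt Y b e Z ≡ true → Σ (T Y ≡ true) λ TY → σ⟨ Y , TY ⟩ Z ≡ true
    blockAt-member Y true e Z m = e , m

    G : Coll n
    G Z = any? (λ Y → blockAt Y (T Y) refl Z)

    G-member : ∀ Z → G Z ≡ true → Σ (Mem T) λ i → σ⟨ i ⟩ Z ≡ true
    G-member Z e with any?-elim (λ Y → blockAt Y (T Y) refl Z) e
    ... | Y , m with blockAt-member Y (T Y) refl Z m
    ...   | TY , m' = (Y , TY) , m'

    G-bounded : Bounded d G
    G-bounded Z e = let (i , m) = G-member Z e in proj₂ (σ-InL i) Z m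

    G-refines : UniquelyRefines G T
    G-refines = refines-uniquely d hT G-bounded λ Z e →
      let ((Y , TY) , m) = G-member Z e in Y , TY , σ-above (Y , TY) Z m

    G-block : ∀ Y (TY : T Y ≡ true) → restrict G Y ≐ σ⟨ Y , TY ⟩
    G-block Y TY Z with σ⟨ Y , TY ⟩ Z in m
    ... | true = ∧-true⁺ (any?-intro (λ Y → blockAt Y (T Y) refl Z) Y (trans (blockAt-spec Y (T Y) refl TY Z) m))
                         (⊆ᵇ-complete (σ-above (Y , TY) Z m))
    ... | false with G Z in g | Y ⊆ᵇ Z in Y⊆ᵇZ
    ...   | false | _ = refl
    ...   | true | false = refl
    ...   | true | true with G-member Z g
    ...     | (Y' , TY') , m' = false≢true (trans (sym m) (subst (λ i → σ⟨ i ⟩ Z ≡ true) i≡ m'))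
      where
      i≡ : (Y' , TY') ≡ (Y , TY)
      i≡ with unique-below d T hT (proj₂ (σ-InL (Y' , TY')) Z m') TY' TY (σ-above (Y' , TY') Z m') (⊆ᵇ-sound Y⊆ᵇZ)
      ... | refl = cong (Y ,_) (bool-irrelevant TY' TY)

    G-InL : InL n d G
    G-InL = union-DPositive d T G hT G-refines (λ Y TY → DPositive-≐ d (G-block Y TY) (proj₁ (σ-InL (Y , TY)))) ,
            G-bounded

    glued : Src
    glued = (G , G-InL) , comparison d (proj₁ G-InL) bT G-refines

  iso : Ideal n d T ≅ Πₚ (Mem T) (λ Ti → Ideal n d ｛ proj₁ Ti ｝)
  iso = block , record
    { isOrderMonomorphism = record
      { isOrderHomomorphism = record
        { cong = λ x≐y i Z → cong (_∧ proj₁ i ⊆ᵇ Z) (x≐y Z)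
        ; mono = λ {x} {y} → block-mono {x} {y} }
      ; injective = λ {x} {y} → block-injective {x} {y}
      ; cancel = λ {x} {y} → block-cancel {x} {y} }
    ; surjective = λ σ → Glue.glued σ , λ z≐ i Z →
        trans (cong (_∧ proj₁ i ⊆ᵇ Z) (z≐ Z)) (Glue.G-block σ (proj₁ i) (proj₂ i) Z) }

-- Contraction along Y,
-- R ↦ {X : Y ∪ X ∈ R}, and its inverse `lift Y` shift every codimension by
-- |Y| (codim-expand) and preserve sizes and intersections, hence D, the
-- defining conditions and the order; the ideal I({Y}) consists exactly of
-- the elements of L(n,d) all of whose members contain Y.

contract : ∀ {n} (Y : Subset n) → Coll n → Coll (cosize Y)
contract Y R X = R (expand Y X)

expand-∑ : ∀ {n} (Y : Subset n) {A : Set} (h : A → Subset (cosize Y)) l →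
  expand Y (∩Sum.∑ h l) ≡ ∩Sum.∑ (λ x → expand Y (h x)) l
expand-∑ Y h [] = expand-⊤ Y
expand-∑ Y h (x ∷ l) = trans (expand-∩ Y (h x) (∩Sum.∑ h l)) (cong (expand Y (h x) ∩_) (expand-∑ Y h l))

module Contraction {n} d (Y : Subset n) (∣Y∣≤d : ∣ Y ∣ ≤ d) where

  m : ℕ
  m = cosize Y

  e : ℕ
  e = d ∸ ∣ Y ∣

  codim-expand : ∀ X → codim d (expand Y X) ≡ codim e X
  codim-expand X = begin
    Z.+ N.suc d Z.- Z.+ ∣ expand Y X ∣
      ≡⟨ cong₂ (λ a b → Z.+ N.suc a Z.- Z.+ b) (sym (NP.m∸n+n≡m ∣Y∣≤d)) (∣expand∣ Y X) ⟩
    Z.+ (N.suc e N.+ ∣ Y ∣) Z.- Z.+ (∣ X ∣ N.+ ∣ Y ∣)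
      ≡⟨ cong₂ Z._-_ (ZP.pos-+ (N.suc e) ∣ Y ∣) (ZP.pos-+ ∣ X ∣ ∣ Y ∣) ⟩
    (Z.+ N.suc e Z.+ Z.+ ∣ Y ∣) Z.- (Z.+ ∣ X ∣ Z.+ Z.+ ∣ Y ∣)
      ≡⟨ cancel (Z.+ N.suc e) (Z.+ ∣ Y ∣) (Z.+ ∣ X ∣) ⟩
    Z.+ N.suc e Z.- Z.+ ∣ X ∣ ∎
    where
    open ≡-Reasoning
    cancel : ∀ a c b → (a Z.+ c) Z.- (b Z.+ c) ≡ a Z.- b
    cancel = solve-∀

  ρ-lift : ∀ (R' : Coll m) → ρ d (lift Y R') ≡ ρ e R'
  ρ-lift R' = trans (ℤSum.over-lift Y R' (codim d)) (ℤSum.over-congʳ R' codim-expand)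

  size-lift : ∀ (R' : Coll m) → size (lift Y R') ≡ size R'
  size-lift R' = trans (size-as-sum (lift Y R')) (trans (ℕSum.over-lift Y R' _) (sym (size-as-sum R')))

  ⋂-lift : ∀ (R' : Coll m) → ⋂ (lift Y R') ≡ expand Y (⋂ R')
  ⋂-lift R' = begin
    ⋂ (lift Y R')                          ≡⟨ ⋂-as-sum (lift Y R') ⟩
    ∩Sum.over (lift Y R') (λ Z → Z)        ≡⟨ ∩Sum.over-lift Y R' (λ Z → Z) ⟩
    ∩Sum.over R' (expand Y)                ≡⟨ ∩Sum.∑-cong expand-if (allSubsets m) ⟩
    ∩Sum.∑ (λ X → expand Y (if R' X then X else ⊤)) (allSubsets m) ≡⟨ sym (expand-∑ Y _ (allSubsets m)) ⟩
    expand Y (∩Sum.over R' (λ X → X))      ≡⟨ cong (expand Y) (sym (⋂-as-sum R')) ⟩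
    expand Y (⋂ R')                        ∎
    where
    open ≡-Reasoning
    expand-if : ∀ X → (if R' X then expand Y X else ⊤) ≡ expand Y (if R' X then X else ⊤)
    expand-if X with R' X
    ... | true = refl
    ... | false = sym (expand-⊤ Y)

  D-lift : ∀ (R' : Coll m) → D d (lift Y R') ≡ D e R'
  D-lift R' = cong₂ Z._-_ (trans (cong (codim d) (⋂-lift R')) (codim-expand (⋂ R'))) (ρ-lift R')

  Above : Coll n → Set
  Above R = ∀ Z → R Z ≡ true → Y ⊆ Z

  lift-contract : ∀ (R : Coll n) → Above R → R ≐ lift Y (contract Y R)
  lift-contract R above Z with Y ⊆ᵇ Z in Y⊆ᵇZ
  ... | true = cong R (sym (expand-compress Y Z (⊆ᵇ-sound Y⊆ᵇZ)))
  ... | false with R Z in RZ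
  ...   | false = refl
  ...   | true = false≢true (trans (sym Y⊆ᵇZ) (⊆ᵇ-complete (above Z RZ)))

  contract-lift : ∀ (R' : Coll m) → contract Y (lift Y R') ≐ R'
  contract-lift R' X rewrite ⊆ᵇ-complete (⊆-expand Y X) | compress-expand Y X = refl

  lift-cong : ∀ {R₁ R₂ : Coll m} → R₁ ≐ R₂ → lift Y R₁ ≐ lift Y R₂
  lift-cong R₁≐R₂ Z = cong (Y ⊆ᵇ Z ∧_) (R₁≐R₂ (compress Y Z))

  lift-InL : ∀ (R' : Coll m) → InL m e R' → InL n d (lift Y R')
  lift-InL R' (hR' , bR') = positive , bounded
    where
    bounded : Bounded d (lift Y R')
    bounded Z l = subst (_≤ d) (cong ∣_∣ (expand-compress Y Z (⊆ᵇ-sound (∧-true⁻ˡ l))))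
      (subst (_≤ d) (sym (∣expand∣ Y (compress Y Z)))
        (subst (∣ compress Y Z ∣ N.+ ∣ Y ∣ ≤_) (NP.m∸n+n≡m ∣Y∣≤d)
          (NP.+-monoˡ-≤ ∣ Y ∣ (bR' (compress Y Z) (∧-true⁻ʳ {Y ⊆ᵇ Z} l)))))
    positive : DPositive d (lift Y R')
    positive U U⊆ |U|>1 = subst (Z.0ℤ Z.<_) (sym (trans (D-cong d U≐) (D-lift (contract Y U))))
      (hR' (contract Y U) U/Y⊆R' (subst (1 N.<_) (trans (size-cong U≐) (size-lift (contract Y U))) |U|>1))
      where
      U≐ : U ≐ lift Y (contract Y U)
      U≐ = lift-contract U (λ Z u → ⊆ᵇ-sound (∧-true⁻ˡ (U⊆ Z u)))
      U/Y⊆R' : contract Y U ⊆ᶜ R'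
      U/Y⊆R' X u = subst (λ V → R' V ≡ true) (compress-expand Y X) (∧-true⁻ʳ {Y ⊆ᵇ expand Y X} (U⊆ (expand Y X) u))

  contract-InL : ∀ (R : Coll n) → InL n d R → Above R → InL m e (contract Y R)
  contract-InL R (hR , bR) above = positive , bounded
    where
    bounded : Bounded e (contract Y R)
    bounded X r = NP.m+n≤o⇒m≤o∸n ∣ X ∣ (subst (_≤ d) (∣expand∣ Y X) (bR (expand Y X) r))
    positive : DPositive e (contract Y R)
    positive U' U'⊆ |U'|>1 = subst (Z.0ℤ Z.<_) (D-lift U')
      (hR (lift Y U') lift⊆R (subst (1 N.<_) (sym (size-lift U')) |U'|>1))
      where
      lift⊆R : lift Y U' ⊆ᶜ R
      lift⊆R Z u = subst (λ V → R V ≡ true) (expand-compress Y Z (⊆ᵇ-sound (∧-true⁻ˡ u)))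
                     (U'⊆ (compress Y Z) (∧-true⁻ʳ {Y ⊆ᵇ Z} u))

  lift-mono : ∀ {R₁ R₂ : Coll m} → R₁ ≤[ e ] R₂ → lift Y R₁ ≤[ d ] lift Y R₂
  lift-mono (inj₂ R₁≐R₂) = inj₂ (lift-cong R₁≐R₂)
  lift-mono {R₁} {R₂} (inj₁ (ρ< , refines)) = inj₁ (subst₂ Z._<_ (sym (ρ-lift R₁)) (sym (ρ-lift R₂)) ρ< , lifted)
    where
    lifted : Refines (lift Y R₁) (lift Y R₂)
    lifted Z l with refines (compress Y Z) (∧-true⁻ʳ {Y ⊆ᵇ Z} l)
    ... | W , R₂W , W⊆ =
      expand Y W ,
      ∧-true⁺ (⊆ᵇ-complete (⊆-expand Y W)) (subst (λ V → R₂ V ≡ true) (sym (compress-expand Y W)) R₂W) ,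
      subst (expand Y W ⊆_) (expand-compress Y Z (⊆ᵇ-sound (∧-true⁻ˡ l))) (expand-mono Y W⊆)

  lift-cancel : ∀ {R₁ R₂ : Coll m} → lift Y R₁ ≤[ d ] lift Y R₂ → R₁ ≤[ e ] R₂
  lift-cancel {R₁} {R₂} (inj₂ lifts≐) =
    inj₂ (λ X → trans (sym (contract-lift R₁ X)) (trans (lifts≐ (expand Y X)) (contract-lift R₂ X)))
  lift-cancel {R₁} {R₂} (inj₁ (ρ< , refines)) = inj₁ (subst₂ Z._<_ (ρ-lift R₁) (ρ-lift R₂) ρ< , contracted)
    where
    contracted : Refines R₁ R₂
    contracted X r with refines (expand Y X) (trans (contract-lift R₁ X) r)
    ... | W , l , W⊆ = compress Y W , ∧-true⁻ʳ {Y ⊆ᵇ W} l , compress-⊆ Y X W⊆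

  lift-｛⊥｝ : lift Y ｛ ⊥ {m} ｝ ≐ ｛ Y ｝
  lift-｛⊥｝ Z with Y ⊆ᵇ Z in Y⊆ᵇZ | ｛ Y ｝ Z in Z∈｛Y｝
  ... | false | false = refl
  ... | false | true = false≢true (trans (sym Y⊆ᵇZ) (⊆ᵇ-complete (SP.⊆-reflexive (sym (｛｝-member {X = Y} {Y = Z} Z∈｛Y｝)))))
  ... | true | true = trans (cong (λ V → ｛ ⊥ ｝ (compress Y V)) (｛｝-member {X = Y} {Y = Z} Z∈｛Y｝))
                        (trans (cong ｛ ⊥ ｝ (compress-self Y)) (｛｝-refl (⊥ {m})))
  ... | true | false with ｛ ⊥ ｝ (compress Y Z) in c∈｛⊥｝
  ...   | false = refl
  ...   | true = false≢true (trans (sym Z∈｛Y｝) (trans (cong ｛ Y ｝ Z≡Y) (｛｝-refl Y)))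
    where
    Z≡Y : Z ≡ Y
    Z≡Y = trans (sym (expand-compress Y Z (⊆ᵇ-sound Y⊆ᵇZ)))
            (trans (cong (expand Y) (｛｝-member {X = ⊥} c∈｛⊥｝)) (expand-⊥ Y))

  below-｛⊥｝ : ∀ (R' : Coll m) → DPositive e R' → R' ≤[ e ] ｛ ⊥ ｝
  below-｛⊥｝ R' hR' =
    comparison e hR' (Bounded-｛｝ (subst (_≤ e) (sym (SP.∣⊥∣≡0 m)) N.z≤n)) (refines-｛｝ (λ Z _ → SP.⊆-min Z))

  Src : Set
  Src = Pos.Carrier (Ideal n d ｛ Y ｝)

  ⟦_⟧ : Src → Coll n
  ⟦ x ⟧ = proj₁ (proj₁ x)

  above : ∀ (x : Src) → Above ⟦ x ⟧
  above x Z r with ≤⇒refines d (proj₂ x) Z r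
  ... | W , W∈ , W⊆Z = subst (_⊆ Z) (｛｝-member {X = Y} {Y = W} W∈) W⊆Z

  contract-elem : Src → L m e
  contract-elem x = contract Y ⟦ x ⟧ , contract-InL ⟦ x ⟧ (proj₂ (proj₁ x)) (above x)

  lift-elem : L m e → Src
  lift-elem (R' , R'∈L) =
    (lift Y R' , lift-InL R' R'∈L) , ≤-resp-≐ d (λ _ → refl) lift-｛⊥｝ (lift-mono (below-｛⊥｝ R' (proj₁ R'∈L)))

  iso : Ideal n d ｛ Y ｝ ≅ Lₚ m e
  iso = contract-elem , record
    { isOrderMonomorphism = record
      { isOrderHomomorphism = record
        { cong = λ x≐y X → x≐y (expand Y X)
        ; mono = λ {x} {y} x≤y → lift-cancel (≤-resp-≐ d (lift-contract ⟦ x ⟧ (above x)) (lift-contract ⟦ y ⟧ (above y)) x≤y) }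
      ; injective = λ {x} {y} same Z →
          trans (lift-contract ⟦ x ⟧ (above x) Z) (trans (lift-cong same Z) (sym (lift-contract ⟦ y ⟧ (above y) Z)))
      ; cancel = λ {x} {y} below → ≤-resp-≐ d (λ Z → sym (lift-contract ⟦ x ⟧ (above x) Z))
                                          (λ Z → sym (lift-contract ⟦ y ⟧ (above y) Z)) (lift-mono below) }
    ; surjective = λ R → lift-elem R , λ z≐ X → trans (z≐ (expand Y X)) (contract-lift (proj₁ R) X) }

  iso′ : Ideal n d ｛ Y ｝ ≅ Lₚ (n ∸ ∣ Y ∣) (d ∸ ∣ Y ∣)
  iso′ = subst (λ k → Ideal n d ｛ Y ｝ ≅ Lₚ k (d ∸ ∣ Y ∣)) (cosize≡ Y) iso

≅-trans : ∀ {P Q R : Pos} → P ≅ Q → Q ≅ R → P ≅ R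
≅-trans (f , f-iso) (g , g-iso) = (λ x → g (f x)) , record
  { isOrderMonomorphism = record
    { isOrderHomomorphism = record { cong = λ e → G.cong (F.cong e) ; mono = λ e → G.mono (F.mono e) }
    ; injective = λ e → F.injective (G.injective e)
    ; cancel = λ e → F.cancel (G.cancel e) }
  ; surjective = λ z → proj₁ (F.surjective (proj₁ (G.surjective z))) ,
      λ w≈x → proj₂ (G.surjective z) (proj₂ (F.surjective (proj₁ (G.surjective z))) w≈x) }
  where
  module F = IsOrderIsomorphism f-iso
  module G = IsOrderIsomorphism g-iso

≅-Π : ∀ {I : Set} {P Q : I → Pos} → (∀ i → P i ≅ Q i) → Πₚ I P ≅ Πₚ I Q
≅-Π φ = (λ σ i → proj₁ (φ i) (σ i)) , record
  { isOrderMonomorphism = record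
    { isOrderHomomorphism = record
      { cong = λ e i → Φ.cong i (e i)
      ; mono = λ e i → Φ.mono i (e i) }
    ; injective = λ e i → Φ.injective i (e i)
    ; cancel = λ e i → Φ.cancel i (e i) }
  ; surjective = λ τ → (λ i → proj₁ (Φ.surjective i (τ i))) , λ z≈ i → proj₂ (Φ.surjective i (τ i)) (z≈ i) }
  where
  module Φ i = IsOrderIsomorphism (proj₂ (φ i))

-- Theorem 3.1.  Only T ∈ L(n,d) is used.
theorem3p1 : (n d : ℕ) → 1 ≤ d → d < n → (T : L n d) → ¬ (proj₁ T ≐ ∅ᶜ) →
    (Ideal n d (proj₁ T) ≅ Πₚ (Mem (proj₁ T)) (λ Ti → Ideal n d ｛ proj₁ Ti ｝))
    × (Ideal n d (proj₁ T) ≅ Πₚ (Mem (proj₁ T)) (λ Ti → Lₚ (n ∸ ∣ proj₁ Ti ∣) (d ∸ ∣ proj₁ Ti ∣)))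
    × (Πₚ (Mem (proj₁ T)) (λ Ti → Ideal n d ｛ proj₁ Ti ｝)
    ≅ Πₚ (Mem (proj₁ T)) (λ Ti → Lₚ (n ∸ ∣ proj₁ Ti ∣) (d ∸ ∣ proj₁ Ti ∣)))
theorem3p1 n d _ _ (T , hT , bT) _ = ideal≅blocks , ≅-trans ideal≅blocks blocks≅links , blocks≅links
  where
  ideal≅blocks : Ideal n d T ≅ Πₚ (Mem T) (λ Ti → Ideal n d ｛ proj₁ Ti ｝)
  ideal≅blocks = BlockDecomposition.iso d T hT bT
  blocks≅links : Πₚ (Mem T) (λ Ti → Ideal n d ｛ proj₁ Ti ｝)
               ≅ Πₚ (Mem T) (λ Ti → Lₚ (n ∸ ∣ proj₁ Ti ∣) (d ∸ ∣ proj₁ Ti ∣))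
  blocks≅links = ≅-Π (λ Ti → Contraction.iso′ d (proj₁ Ti) (bT (proj₁ Ti) (proj₂ Ti)))
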